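{- Let $(S,\otimes,\mathbf{1})$ be a monoid. In a finger B-tree with aggregates that contains $\langle t_1,v_1\rangle,\ldots,\langle t_n,v_n\rangle$ (with $t_1<\dots<t_n$), the operation query$()$ returns $v_1\otimes\cdots\otimes v_n$.
   Context: A monoid is a triple $(S,\otimes,\mathbf{1})$ with $\otimes$ associative (not necessarily commutative or invertible) and identity $\mathbf{1}$. A finger B-tree with aggregates with parameter $\mu\geq 2$ (MIN_ARITY $=\mu$, MAX_ARITY $=2\mu$) is a search tree keyed by timestamps from a totally ordered set: each node $y$ has arity $a=a(y)$, stores $a-1$ time-ordered pairs $\langle t_0,v_0\rangle,\dots,\langle t_{a-2},v_{a-2}\rangle$ and, if it is not a leaf, children $z_0,\dots,z_{a-1}$, with all timestamps in the subtree of $z_j$ lying between $t_{j-1}$ and $t_j$; all leaves have the same depth; non-root nodes satisfy $\mu\le a\le 2\mu$ and the root $2\le a\le 2\mu$; each node has a parent pointer, and there are pointers (fingers) to the leftmost leaf (left finger) and rightmost leaf (right finger). The left spine is the root-to-left-finger path, the right spine the root-to-right-finger path. The contents of the tree are all its pairs in time order. For a node $y$ define the up-aggregate $\Pi_\uparrow(y)=\Pi_\uparrow(z_0)\otimes v_0\otimes\Pi_\uparrow(z_1)\otimes\cdots\otimes v_{a-2}\otimes\Pi_\uparrow(z_{a-1})$ (for a leaf, $v_0\otimes\cdots\otimes v_{a-2}$). Aggregation invariants: (i) the root stores the inner aggregate, which is $v_0\otimes\cdots\otimes v_{a-2}$ if the root is a leaf and otherwise $v_0\otimes\Pi_\uparrow(z_1)\otimes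 v_1\otimes\cdots\otimes\Pi_\uparrow(z_{a-2})\otimes v_{a-2}$ (everything except the subtrees of its leftmost and rightmost children); (ii) each non-root node $y$ on the left spine stores the left aggregate $\Pi_\swarrow(y)=v_0\otimes\Pi_\uparrow(z_1)\otimes v_1\otimes\cdots\otimes v_{a-2}\otimes\Pi_\uparrow(z_{a-1})\otimes\Pi_\swarrow(\mathrm{parent}(y))$, where the child factors are absent for a leaf and the last factor is absent if the parent is the root (so it is the aggregate of the subtree of the root's leftmost child except the subtree of $z_0$); (iii) symmetrically each non-root node $y$ on the right spine stores $\Pi_\searrow(y)=\Pi_\searrow(\mathrm{parent}(y))\otimes\Pi_\uparrow(z_0)\otimes v_0\otimes\cdots\otimes\Pi_\uparrow(z_{a-2})\otimes v_{a-2}$ (last-parent factor absent if the parent is the root, child factors absent for a leaf); (iv) every other node stores $\Pi_\uparrow(y)$. The operation query$()$ returns the root's stored aggregate if the root is a leaf, and otherwise (left finger's stored aggregate) $\otimes$ (root's stored aggregate) $\otimes$ (right finger's stored aggregate). -}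

module Defs where

open import Level using (Level; _⊔_)
open import Algebra.Bundles using (Monoid)
open import Relation.Binary.Bundles using (StrictTotalOrder)
open import Data.Nat using (ℕ; zero; suc; _≤_; _*_)
open import Data.List using (List; []; _∷_; _++_; length; foldr; map)
open import Data.List.Relation.Unary.All using (All)
open import Data.Maybe using (Maybe; just; nothing)
open import Data.Product using (_×_; _,_; proj₁; proj₂; Σ)
open import Data.Unit.Polymorphic using (⊤)
open import Relation.Binary.PropositionalEquality using (_≡_)

-- Parent pointers and fingers are not stored
-- explicitly: they are determined by the (inductive) tree shape, and the
-- left/right fingers are computed as the leftmost/rightmost leaves.
module FingerTree {c ℓ a ℓ₁ ℓ₂ : Level}
                  (M : Monoid c ℓ) (O : StrictTotalOrder a ℓ₁ ℓ₂) where

  open Monoid M renaming (Carrier to V)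
  open StrictTotalOrder O using () renaming (Carrier to T; _<_ to _<ₜ_)

  Pair : Set (a ⊔ c)
  Pair = T × V

  -- A node stores its aggregate field.
  --  * leaf s [p₀,…,p_{a-2}]                       : leaf of arity a
  --  * branch s z₀ [(p₀,z₁),…,(p_{a-2},z_{a-1})]    : inner node of arity a
  data Node : Set (a ⊔ c) where
    leaf   : (stored : V) → List Pair → Node
    branch : (stored : V) → Node → List (Pair × Node) → Node

  stored : Node → V
  stored (leaf s _)     = s
  stored (branch s _ _) = s

  arity : Node → ℕ
  arity (leaf _ ps)       = suc (length ps)
  arity (branch _ _ rest) = suc (length rest)

  mutual
    contents : Node → List Pair
    contents (leaf _ ps)       = ps
    contents (branch _ z rest) = contents z ++ contentsRest rest

    contentsRest : List (Pair × Node) → List Pair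
    contentsRest []              = []
    contentsRest ((p , z) ∷ r)   = p ∷ (contents z ++ contentsRest r)

  prodV : List Pair → V
  prodV = foldr (λ p acc → proj₂ p ∙ acc) ε

  mutual
    Πup : Node → V
    Πup (leaf _ ps)       = prodV ps
    Πup (branch _ z rest) = Πup z ∙ ΠupRest rest

    ΠupRest : List (Pair × Node) → V
    ΠupRest []                     = ε
    ΠupRest (((t , v) , z) ∷ r)    = v ∙ (Πup z ∙ ΠupRest r)

  reassoc : Node → List (Pair × Node) → List (Node × Pair) × Node
  reassoc z []              = [] , z
  reassoc z ((p , z') ∷ r) with reassoc z' r
  ... | xs , l = (z , p) ∷ xs , l

  prodInit : List (Node × Pair) → V
  prodInit = foldr (λ x acc → Πup (proj₁ x) ∙ (proj₂ (proj₂ x) ∙ acc)) ε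

  _⊗?_ : V → Maybe V → V
  x ⊗? nothing = x
  x ⊗? just p  = x ∙ p

  _?⊗_ : Maybe V → V → V
  nothing ?⊗ x = x
  just p  ?⊗ x = p ∙ x

  -- (iv) nodes off the spines store Π↑ (whole subtree)
  data UpOK : Node → Set (a ⊔ c ⊔ ℓ) where
    leafU   : ∀ {s ps} → s ≈ prodV ps → UpOK (leaf s ps)
    branchU : ∀ {s z rest} → s ≈ Πup (branch s z rest) →
              UpOK z → All (λ x → UpOK (proj₂ x)) rest →
              UpOK (branch s z rest)

  -- (ii) non-root left-spine nodes; pf = Π↙(parent), or nothing if parent is root
  data LeftOK : Maybe V → Node → Set (a ⊔ c ⊔ ℓ) where
    leafL   : ∀ {pf s ps} → s ≈ (prodV ps ⊗? pf) → LeftOK pf (leaf s ps)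
    branchL : ∀ {pf s z rest} → s ≈ (ΠupRest rest ⊗? pf) →
              LeftOK (just (ΠupRest rest ⊗? pf)) z →
              All (λ x → UpOK (proj₂ x)) rest →
              LeftOK pf (branch s z rest)

  -- (iii) non-root right-spine nodes; pf = Π↘(parent), or nothing if parent is root
  data RightOK : Maybe V → Node → Set (a ⊔ c ⊔ ℓ) where
    leafR   : ∀ {pf s ps} → s ≈ (pf ?⊗ prodV ps) → RightOK pf (leaf s ps)
    branchR : ∀ {pf s z rest xs l} → reassoc z rest ≡ (xs , l) →
              s ≈ (pf ?⊗ prodInit xs) →
              RightOK (just (pf ?⊗ prodInit xs)) l →
              All (λ x → UpOK (proj₁ x)) xs →
              RightOK pf (branch s z rest)

  -- (i) the root stores the inner aggregate; its children are handled by (ii)-(iv)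
  data RootOK : Node → Set (a ⊔ c ⊔ ℓ) where
    leafRoot   : ∀ {s ps} → s ≈ prodV ps → RootOK (leaf s ps)
    branchRoot : ∀ {s z rest t₀ v₀ xs l} →
                 reassoc z rest ≡ ((z , (t₀ , v₀)) ∷ xs , l) →
                 s ≈ (v₀ ∙ prodInit xs) →
                 LeftOK nothing z → RightOK nothing l →
                 All (λ x → UpOK (proj₁ x)) xs →
                 RootOK (branch s z rest)

  data Height : ℕ → Node → Set (a ⊔ c) where
    leafH   : ∀ {s ps} → Height 0 (leaf s ps)
    branchH : ∀ {h s z rest} → Height h z → All (λ x → Height h (proj₂ x)) rest →
              Height (suc h) (branch s z rest)

  data NonRootArities (μ : ℕ) : Node → Set (a ⊔ c) where
    leafA   : ∀ {s ps} → μ ≤ arity (leaf s ps) → arity (leaf s ps) ≤ 2 * μ →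
              NonRootArities μ (leaf s ps)
    branchA : ∀ {s z rest} → μ ≤ arity (branch s z rest) →
              arity (branch s z rest) ≤ 2 * μ →
              NonRootArities μ z → All (λ x → NonRootArities μ (proj₂ x)) rest →
              NonRootArities μ (branch s z rest)

  data Arities (μ : ℕ) : Node → Set (a ⊔ c) where
    leafRA   : ∀ {s ps} → 2 ≤ arity (leaf s ps) → arity (leaf s ps) ≤ 2 * μ →
               Arities μ (leaf s ps)
    branchRA : ∀ {s z rest} → 2 ≤ arity (branch s z rest) →
               arity (branch s z rest) ≤ 2 * μ →
               NonRootArities μ z → All (λ x → NonRootArities μ (proj₂ x)) rest →
               Arities μ (branch s z rest)

  -- search-tree order with optional bounds (nothing = unbounded)
  Lt : Maybe T → Maybe T → Set (ℓ₂)
  Lt (just x) (just y) = x <ₜ y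
  Lt _        _        = ⊤

  data Chain (lo hi : Maybe T) : List Pair → Set (a ⊔ c ⊔ ℓ₂) where
    nilC  : Lt lo hi → Chain lo hi []
    consC : ∀ {t v ps} → Lt lo (just t) → Chain (just t) hi ps → Chain lo hi ((t , v) ∷ ps)

  mutual
    data Sorted (lo hi : Maybe T) : Node → Set (a ⊔ c ⊔ ℓ₂) where
      leafS   : ∀ {s ps} → Chain lo hi ps → Sorted lo hi (leaf s ps)
      branchS : ∀ {s z rest} → SortedKids lo hi z rest → Sorted lo hi (branch s z rest)

    data SortedKids (lo hi : Maybe T) : Node → List (Pair × Node) → Set (a ⊔ c ⊔ ℓ₂) where
      lastK : ∀ {z} → Sorted lo hi z → SortedKids lo hi z []
      nextK : ∀ {z t v z' rest} → Sorted lo (just t) z →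
              SortedKids (just t) hi z' rest → SortedKids lo hi z (((t , v) , z') ∷ rest)

  record IsFingerBTree (μ : ℕ) (root : Node) : Set (a ⊔ c ⊔ ℓ ⊔ ℓ₂) where
    field
      height     : Σ ℕ (λ h → Height h root)
      arities    : Arities μ root
      searchTree : Sorted nothing nothing root
      aggregates : RootOK root

  leftFinger : Node → Node
  leftFinger (leaf s ps)       = leaf s ps
  leftFinger (branch _ z _)    = leftFinger z

  mutual
    rightFinger : Node → Node
    rightFinger (leaf s ps)          = leaf s ps
    rightFinger (branch _ z [])      = rightFinger z
    rightFinger (branch _ _ (x ∷ r)) = rightFingerL x r

    rightFingerL : Pair × Node → List (Pair × Node) → Node
    rightFingerL (_ , z) []      = rightFinger z
    rightFingerL _       (x ∷ r) = rightFingerL x r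

  query : Node → V
  query (leaf s _)         = s
  query r@(branch s _ _)   = stored (leftFinger r) ∙ (s ∙ stored (rightFinger r))

{-# OPTIONS --safe #-}
module Submission where

open import Defs
open import Level using (Level)
open import Algebra.Bundles using (Monoid)
open import Relation.Binary.Bundles using (StrictTotalOrder)
open import Data.Nat using (ℕ; _≤_)
open import Data.List using ([]; _∷_; _++_)
open import Data.Maybe using (just; nothing)
open import Data.Product using (_,_)
open import Relation.Binary.PropositionalEquality as ≡ using (_≡_)
import Relation.Binary.Reasoning.Setoid as SetoidReasoning

-- Every stored aggregate is the product of a contiguous block of the contents.
-- Going down the left spine, the accumulated left aggregates show that the left
-- finger stores the product of the whole subtree of the root's leftmost child;
-- symmetrically the right finger stores that of the rightmost child, and the
-- root stores everything in between.  Associativity glues the three blocks.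

module Aggregates {c ℓ a ℓ₁ ℓ₂ : Level} (M : Monoid c ℓ) (O : StrictTotalOrder a ℓ₁ ℓ₂) where
  open FingerTree M O
  open Monoid M renaming (Carrier to V)
  open SetoidReasoning setoid

  ⊗?-assoc : ∀ x y pf → (x ∙ y) ⊗? pf ≈ x ∙ (y ⊗? pf)
  ⊗?-assoc x y nothing  = refl
  ⊗?-assoc x y (just p) = assoc x y p

  ?⊗-assoc : ∀ pf x y → (pf ?⊗ x) ∙ y ≈ pf ?⊗ (x ∙ y)
  ?⊗-assoc nothing  x y = refl
  ?⊗-assoc (just p) x y = assoc p x y

  ?⊗-congˡ : ∀ pf {x y} → x ≈ y → pf ?⊗ x ≈ pf ?⊗ y
  ?⊗-congˡ nothing  x≈y = x≈y
  ?⊗-congˡ (just p) x≈y = ∙-congˡ x≈y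

  prodV-++ : ∀ xs ys → prodV (xs ++ ys) ≈ prodV xs ∙ prodV ys
  prodV-++ []             ys = sym (identityˡ (prodV ys))
  prodV-++ ((t , v) ∷ xs) ys = trans (∙-congˡ (prodV-++ xs ys)) (sym (assoc v _ _))

  mutual
    Πup≈prodV-contents : ∀ y → Πup y ≈ prodV (contents y)
    Πup≈prodV-contents (leaf _ ps)       = refl
    Πup≈prodV-contents (branch _ z rest) = begin
      Πup z ∙ ΠupRest rest                           ≈⟨ ∙-cong (Πup≈prodV-contents z) (ΠupRest≈prodV-contentsRest rest) ⟩
      prodV (contents z) ∙ prodV (contentsRest rest) ≈⟨ prodV-++ (contents z) (contentsRest rest) ⟨
      prodV (contents z ++ contentsRest rest)        ∎

    ΠupRest≈prodV-contentsRest : ∀ r → ΠupRest r ≈ prodV (contentsRest r)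
    ΠupRest≈prodV-contentsRest []                  = refl
    ΠupRest≈prodV-contentsRest (((t , v) , z) ∷ r) = ∙-congˡ (begin
      Πup z ∙ ΠupRest r                           ≈⟨ ∙-cong (Πup≈prodV-contents z) (ΠupRest≈prodV-contentsRest r) ⟩
      prodV (contents z) ∙ prodV (contentsRest r) ≈⟨ prodV-++ (contents z) (contentsRest r) ⟨
      prodV (contents z ++ contentsRest r)        ∎)

  Πup-reassoc : ∀ z rest {xs l} → reassoc z rest ≡ (xs , l) →
                Πup z ∙ ΠupRest rest ≈ prodInit xs ∙ Πup l
  Πup-reassoc z [] ≡.refl = trans (identityʳ (Πup z)) (sym (identityˡ (Πup z)))
  Πup-reassoc z (((t , v) , z′) ∷ r) eq with reassoc z′ r in eq′ | eq
  ... | xs , l | ≡.refl = begin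
    Πup z ∙ (v ∙ (Πup z′ ∙ ΠupRest r))  ≈⟨ ∙-congˡ (∙-congˡ (Πup-reassoc z′ r eq′)) ⟩
    Πup z ∙ (v ∙ (prodInit xs ∙ Πup l)) ≈⟨ ∙-congˡ (assoc v _ _) ⟨
    Πup z ∙ ((v ∙ prodInit xs) ∙ Πup l) ≈⟨ assoc (Πup z) _ _ ⟨
    (Πup z ∙ (v ∙ prodInit xs)) ∙ Πup l ∎

  rightFingerL≡rightFinger : ∀ s p z r → rightFingerL (p , z) r ≡ rightFinger (branch s z r)
  rightFingerL≡rightFinger s p z []      = ≡.refl
  rightFingerL≡rightFinger s p z (_ ∷ _) = ≡.refl

  rightFinger-reassoc : ∀ s z rest {xs l} → reassoc z rest ≡ (xs , l) →
                        rightFinger (branch s z rest) ≡ rightFinger l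
  rightFinger-reassoc s z [] ≡.refl = ≡.refl
  rightFinger-reassoc s z ((p , z′) ∷ r) eq with reassoc z′ r in eq′ | eq
  ... | _ | ≡.refl = ≡.trans (rightFingerL≡rightFinger s p z′ r) (rightFinger-reassoc s z′ r eq′)

  leftFinger-stored : ∀ {pf y} → LeftOK pf y → stored (leftFinger y) ≈ Πup y ⊗? pf
  leftFinger-stored (leafL s≈) = s≈
  leftFinger-stored {pf} {branch _ z rest} (branchL _ zOK _) =
    trans (leftFinger-stored zOK) (sym (⊗?-assoc (Πup z) (ΠupRest rest) pf))

  rightFinger-stored : ∀ {pf y} → RightOK pf y → stored (rightFinger y) ≈ pf ?⊗ Πup y
  rightFinger-stored (leafR s≈) = s≈
  rightFinger-stored {pf} {branch s z rest} (branchR {xs = xs} {l = l} eq _ lOK _) = begin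
    stored (rightFinger (branch s z rest)) ≡⟨ ≡.cong stored (rightFinger-reassoc s z rest eq) ⟩
    stored (rightFinger l)                 ≈⟨ rightFinger-stored lOK ⟩
    (pf ?⊗ prodInit xs) ∙ Πup l            ≈⟨ ?⊗-assoc pf (prodInit xs) (Πup l) ⟩
    pf ?⊗ (prodInit xs ∙ Πup l)            ≈⟨ ?⊗-congˡ pf (Πup-reassoc z rest eq) ⟨
    pf ?⊗ (Πup z ∙ ΠupRest rest)           ∎

  query≈prodV-contents : ∀ root → RootOK root → query root ≈ prodV (contents root)
  query≈prodV-contents (leaf s ps) (leafRoot s≈) = s≈
  query≈prodV-contents (branch s z rest) (branchRoot {v₀ = v₀} {xs = xs} {l = l} eq s≈ zOK lOK _) = begin
    stored (leftFinger z) ∙ (s ∙ stored (rightFinger (branch s z rest)))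
      ≡⟨ ≡.cong (λ r → stored (leftFinger z) ∙ (s ∙ stored r)) (rightFinger-reassoc s z rest eq) ⟩
    stored (leftFinger z) ∙ (s ∙ stored (rightFinger l))
      ≈⟨ ∙-cong (leftFinger-stored zOK) (∙-cong s≈ (rightFinger-stored lOK)) ⟩
    Πup z ∙ ((v₀ ∙ prodInit xs) ∙ Πup l) ≈⟨ assoc (Πup z) _ _ ⟨
    (Πup z ∙ (v₀ ∙ prodInit xs)) ∙ Πup l ≈⟨ Πup-reassoc z rest eq ⟨
    Πup z ∙ ΠupRest rest                 ≈⟨ Πup≈prodV-contents (branch s z rest) ⟩
    prodV (contents (branch s z rest))   ∎

theorem3p3 : ∀ {c ℓ a ℓ₁ ℓ₂ : Level} (M : Monoid c ℓ) (O : StrictTotalOrder a ℓ₁ ℓ₂)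
               (μ : ℕ) → 2 ≤ μ → (root : FingerTree.Node M O) →
               FingerTree.IsFingerBTree M O μ root →
               Monoid._≈_ M (FingerTree.query M O root) (FingerTree.prodV M O (FingerTree.contents M O root))
theorem3p3 M O μ _ root isTree =
  Aggregates.query≈prodV-contents M O root (FingerTree.IsFingerBTree.aggregates isTree)
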